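{- Let $k\ge 1$ and use the convention $D_k(j)=0$ for negative integers $j$. Then for every integer $n\ge 0$, $$D_k(2n+1)=\sum_{i\ge 0}\binom{k}{4i+2}D_k(n-i)=\binom{k}{2}D_k(n)+\binom{k}{6}D_k(n-1)+\binom{k}{10}D_k(n-2)+\cdots,$$ $$D_k(2n+2)=\sum_{i\ge 0}\binom{k}{4i}D_k(n+1-i)=\binom{k}{0}D_k(n+1)+\binom{k}{4}D_k(n)+\binom{k}{8}D_k(n-1)+\cdots.$$
   Context: A P-position of the game of Nim with $k$ piles is a $k$-tuple $(p_1,\dots,p_k)$ of non-negative integers whose nim-sum $p_1\oplus\cdots\oplus p_k$ is $0$, where $\oplus$ denotes bitwise XOR. $D_k(n)$ denotes the number of P-positions with $k$ piles whose total number of counters equals exactly $2n$. Binomial coefficients $\binom{k}{m}$ with $m>k$ are $0$. -}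

module Defs where

open import Data.Nat using (ℕ; zero; suc; _+_; _*_; _∸_; _≟_)
open import Data.Nat.DivMod using (_/_; _%_)
open import Data.Bool using (Bool; true; false; _xor_)
open import Data.List using (List; []; _∷_; length; filter; concatMap; upTo; map)
open import Data.Nat.ListAction using (sum)
open import Relation.Nullary.Decidable using (⌊_⌋)

bit : ℕ → Bool
bit n = ⌊ n % 2 ≟ 1 ⌋

fromBit : Bool → ℕ
fromBit true  = 1
fromBit false = 0

-- Bitwise XOR (nim-sum), computed with fuel; xorF f a b is the nim-sum of a and b
-- whenever a < 2^f and b < 2^f (in particular for f = a + b).
xorF : ℕ → ℕ → ℕ → ℕ
xorF zero    a b = 0
xorF (suc f) a b = fromBit (bit a xor bit b) + 2 * xorF f (a / 2) (b / 2)

infixl 6 _⊕_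
_⊕_ : ℕ → ℕ → ℕ
a ⊕ b = xorF (a + b) a b

nimSum : List ℕ → ℕ
nimSum []       = 0
nimSum (p ∷ ps) = p ⊕ nimSum ps

compositions : ℕ → ℕ → List (List ℕ)
compositions zero    zero    = [] ∷ []
compositions zero    (suc s) = []
compositions (suc k) s       =
  concatMap (λ p → map (p ∷_) (compositions k (s ∸ p))) (upTo (suc s))

D : ℕ → ℕ → ℕ
D k n = length (filter (λ ps → nimSum ps ≟ 0) (compositions k (2 * n)))

Σ≤ : ℕ → (ℕ → ℕ) → ℕ
Σ≤ m f = sum (map f (upTo (suc m)))

-- Split every pile as p = b + 2q with b ∈ {0,1}. The nim-sum of the piles is then the parity of
-- the number t of odd piles plus twice the nim-sum of the halves q, and the total is t + 2·Σq.
-- So a position with total m is a P-position iff t is even and the halves form a P-position of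
-- total (m − t)/2; choosing the odd piles in C(k,t) ways, the number P(m) of P-positions of
-- total m satisfies P(m) = Σ_{t even} C(k,t) P((m − t)/2). Hence P vanishes on odd totals and
-- P(2M) = Σ_j C(k,2j) P(M − j). Taking M = 2n+1 resp. M = 2n+2 and dropping the odd arguments
-- M − j leaves exactly the terms j = 2i+1 resp. j = 2i, i.e. the two identities for D k = P ∘ (2 *_).

module Submission where

open import Defs
open import Data.Bool using (Bool; true; false; not; _xor_)
open import Data.Bool.Properties using (not-involutive)
open import Data.Empty using (⊥-elim)
open import Data.List using (List; []; _∷_; _++_; length; filter; concatMap; upTo; applyUpTo; map)
open import Data.List.Properties using (map-++; map-upTo; map-∘)
open import Data.Nat using (ℕ; zero; suc; _+_; _*_; _∸_; _≤_; _<_; z≤n; s≤s; _≡ᵇ_; _≟_)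
open import Data.Nat.Properties
open import Algebra.Properties.CommutativeSemigroup +-commutativeSemigroup using () renaming (interchange to +-interchange)
open import Algebra.Properties.CommutativeSemigroup *-commutativeSemigroup using (x∙yz≈y∙xz)
open import Data.Nat.DivMod using (_/_; _%_; %-congˡ; [m+n]%n≡m%n; [m+kn]%n≡m%n; +-distrib-/-∣ʳ; m*n/n≡m; m/n<m; m/n≤m)
open import Data.Nat.Divisibility using (divides-refl)
open import Data.Nat.Combinatorics using (_C_; nCk+nC[k+1]≡[n+1]C[k+1]; k>n⇒nCk≡0)
open import Data.Nat.ListAction using (sum)
open import Data.Nat.ListAction.Properties using (sum-++)
open import Data.Nat.Tactic.RingSolver using (solve-∀)
open import Data.Product using (_×_; _,_)
open import Data.Vec using (Vec; []; _∷_; toList; zipWith)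
import Data.Vec as Vec
open import Function using (_∘_)
open import Relation.Nullary using (does)
open import Relation.Nullary.Decidable using (⌊_⌋)
open import Relation.Unary using (Pred; Decidable)
open import Level using (0ℓ)
open import Relation.Binary.PropositionalEquality
open ≡-Reasoning

-- Finite sums

∑< : ℕ → (ℕ → ℕ) → ℕ
∑< zero    f = 0
∑< (suc n) f = f 0 + ∑< n (f ∘ suc)

infixl 10 ∑<
syntax ∑< n (λ i → e) = ∑[ i < n ] e

∑-cong-< : ∀ n {f g : ℕ → ℕ} → (∀ i → i < n → f i ≡ g i) → ∑< n f ≡ ∑< n g
∑-cong-< zero    eq = refl
∑-cong-< (suc n) eq = cong₂ _+_ (eq 0 (s≤s z≤n)) (∑-cong-< n (λ i i<n → eq (suc i) (s≤s i<n)))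

∑-cong : ∀ n {f g : ℕ → ℕ} → (∀ i → f i ≡ g i) → ∑< n f ≡ ∑< n g
∑-cong n eq = ∑-cong-< n (λ i _ → eq i)

∑-zero : ∀ n {f : ℕ → ℕ} → (∀ i → f i ≡ 0) → ∑< n f ≡ 0
∑-zero zero    eq = refl
∑-zero (suc n) eq = cong₂ _+_ (eq 0) (∑-zero n (eq ∘ suc))

∑-distrib-+ : ∀ n (f g : ℕ → ℕ) → ∑[ i < n ] (f i + g i) ≡ ∑< n f + ∑< n g
∑-distrib-+ zero    f g = refl
∑-distrib-+ (suc n) f g = begin
  f 0 + g 0 + ∑[ i < n ] (f (suc i) + g (suc i))          ≡⟨ cong (f 0 + g 0 +_) (∑-distrib-+ n (f ∘ suc) (g ∘ suc)) ⟩
  f 0 + g 0 + (∑< n (f ∘ suc) + ∑< n (g ∘ suc))           ≡⟨ +-interchange (f 0) (g 0) _ _ ⟩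
  f 0 + ∑< n (f ∘ suc) + (g 0 + ∑< n (g ∘ suc))           ∎

*-distribˡ-∑ : ∀ n c (f : ℕ → ℕ) → c * ∑< n f ≡ ∑[ i < n ] (c * f i)
*-distribˡ-∑ zero    c f = *-zeroʳ c
*-distribˡ-∑ (suc n) c f = trans (*-distribˡ-+ c (f 0) _) (cong (c * f 0 +_) (*-distribˡ-∑ n c (f ∘ suc)))

∑-comm : ∀ m n (f : ℕ → ℕ → ℕ) → ∑[ i < m ] ∑[ j < n ] f i j ≡ ∑[ j < n ] ∑[ i < m ] f i j
∑-comm zero    n f = sym (∑-zero n (λ _ → refl))
∑-comm (suc m) n f = begin
  ∑[ j < n ] f 0 j + ∑[ i < m ] ∑[ j < n ] f (suc i) j    ≡⟨ cong (∑[ j < n ] f 0 j +_) (∑-comm m n (f ∘ suc)) ⟩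
  ∑[ j < n ] f 0 j + ∑[ j < n ] ∑[ i < m ] f (suc i) j    ≡⟨ ∑-distrib-+ n (f 0) _ ⟨
  ∑[ j < n ] (f 0 j + ∑[ i < m ] f (suc i) j)              ∎

∑-truncate : ∀ {m n} (f : ℕ → ℕ) → m ≤ n → (∀ i → m ≤ i → f i ≡ 0) → ∑< n f ≡ ∑< m f
∑-truncate {zero}  {n}     f _         vanish = ∑-zero n (λ i → vanish i z≤n)
∑-truncate {suc m} {suc n} f (s≤s m≤n) vanish =
  cong (f 0 +_) (∑-truncate (f ∘ suc) m≤n (λ i m≤i → vanish (suc i) (s≤s m≤i)))

double : ℕ → ℕ
double zero    = 0
double (suc n) = suc (suc (double n))

double≡2* : ∀ n → double n ≡ 2 * n
double≡2* zero    = refl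
double≡2* (suc n) = trans (cong (suc ∘ suc) (double≡2* n)) (sym (*-suc 2 n))

double-+ : ∀ m n → double (m + n) ≡ double m + double n
double-+ zero    n = refl
double-+ (suc m) n = cong (suc ∘ suc) (double-+ m n)

double-double : ∀ i → double (double i) ≡ 4 * i
double-double i = trans (double≡2* (double i)) (trans (cong (2 *_) (double≡2* i)) (sym (*-assoc 2 2 i)))

n≤double : ∀ n → n ≤ double n
n≤double n = subst (n ≤_) (sym (double≡2* n)) (m≤n*m n 2)

double-∸ : ∀ m n → double m ∸ double n ≡ double (m ∸ n)
double-∸ m       zero    = refl
double-∸ zero    (suc n) = refl
double-∸ (suc m) (suc n) = double-∸ m n

suc-double-∸ : ∀ m n → n ≤ m → suc (double m) ∸ double n ≡ suc (double (m ∸ n))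
suc-double-∸ m       zero    _         = refl
suc-double-∸ (suc m) (suc n) (s≤s n≤m) = suc-double-∸ m n n≤m

∑-double : ∀ n (f : ℕ → ℕ) → ∑< (double n) f ≡ ∑[ i < n ] f (double i) + ∑[ i < n ] f (suc (double i))
∑-double zero    f = refl
∑-double (suc n) f = begin
  f 0 + (f 1 + ∑< (double n) (f ∘ suc ∘ suc))
    ≡⟨ cong (λ s → f 0 + (f 1 + s)) (∑-double n (f ∘ suc ∘ suc)) ⟩
  f 0 + (f 1 + (∑[ i < n ] f (double (suc i)) + ∑[ i < n ] f (suc (double (suc i)))))
    ≡⟨ regroup (f 0) (f 1) _ _ ⟩
  f 0 + ∑[ i < n ] f (double (suc i)) + (f 1 + ∑[ i < n ] f (suc (double (suc i)))) ∎
  where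
  regroup : ∀ a b c d → a + (b + (c + d)) ≡ a + c + (b + d)
  regroup = solve-∀

∑-double-suc : ∀ n (f : ℕ → ℕ) →
  ∑< (suc (double n)) f ≡ ∑[ i < suc n ] f (double i) + ∑[ i < n ] f (suc (double i))
∑-double-suc n f = trans (cong (f 0 +_) (∑-double n (f ∘ suc))) (regroup (f 0) _ _)
  where
  regroup : ∀ a b c → a + (b + c) ≡ a + c + b
  regroup = solve-∀

δ : ℕ → ℕ → ℕ
δ m n = fromBit (m ≡ᵇ n)

δ-sym : ∀ m n → δ m n ≡ δ n m
δ-sym zero    zero    = refl
δ-sym zero    (suc n) = refl
δ-sym (suc m) zero    = refl
δ-sym (suc m) (suc n) = δ-sym m n

δ-cancelˡ-+ : ∀ a m n → δ (a + m) (a + n) ≡ δ m n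
δ-cancelˡ-+ zero    m n = refl
δ-cancelˡ-+ (suc a) m n = δ-cancelˡ-+ a m n

δ-< : ∀ {m n} → m < n → δ m n ≡ 0
δ-< {zero}  {suc n} _         = refl
δ-< {suc m} {suc n} (s≤s m<n) = δ-< m<n

δ-double : ∀ m n → δ (double m) (double n) ≡ δ m n
δ-double zero    zero    = refl
δ-double zero    (suc n) = refl
δ-double (suc m) zero    = refl
δ-double (suc m) (suc n) = δ-double m n

δ-odd-double : ∀ m n → δ (suc (double m)) (double n) ≡ 0
δ-odd-double zero    zero    = refl
δ-odd-double zero    (suc n) = refl
δ-odd-double (suc m) zero    = refl
δ-odd-double (suc m) (suc n) = δ-odd-double m n

∑-δ : ∀ B s (f : ℕ → ℕ) → (B ≤ s → f s ≡ 0) → ∑[ r < B ] (δ s r * f r) ≡ f s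
∑-δ zero    s       f vanish = sym (vanish z≤n)
∑-δ (suc B) zero    f _      =
  trans (cong₂ _+_ (+-identityʳ (f 0)) (∑-zero B (λ _ → refl))) (+-identityʳ (f 0))
∑-δ (suc B) (suc s) f vanish = ∑-δ B s (f ∘ suc) (vanish ∘ s≤s)

∑-δ-shift-≤ : ∀ {B j M} (f : ℕ → ℕ) → j ≤ M → M < B → ∑[ r < B ] (δ M (j + r) * f r) ≡ f (M ∸ j)
∑-δ-shift-≤ {B} {j} {M} f j≤M M<B = begin
  ∑[ r < B ] (δ M (j + r) * f r)
    ≡⟨ ∑-cong B (λ r → cong (_* f r) (trans (cong (λ x → δ x (j + r)) (sym (m+[n∸m]≡n j≤M)))
                                            (δ-cancelˡ-+ j (M ∸ j) r))) ⟩
  ∑[ r < B ] (δ (M ∸ j) r * f r)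
    ≡⟨ ∑-δ B (M ∸ j) f (λ B≤M∸j → ⊥-elim (<⇒≱ (≤-<-trans (m∸n≤m M j) M<B) B≤M∸j)) ⟩
  f (M ∸ j) ∎

∑-δ-shift-> : ∀ {B j M} (f : ℕ → ℕ) → M < j → ∑[ r < B ] (δ M (j + r) * f r) ≡ 0
∑-δ-shift-> {B} {j} f M<j = ∑-zero B (λ r → cong (_* f r) (δ-< (<-≤-trans M<j (m≤m+n j r))))

∑-convolution : ∀ {A B M} (c f : ℕ → ℕ) → (∀ j → A ≤ j → c j ≡ 0) → M < B →
  ∑[ j < A ] (c j * ∑[ r < B ] (δ M (j + r) * f r)) ≡ ∑[ j < suc M ] (c j * f (M ∸ j))
∑-convolution {A} {B} {M} c f c-vanish M<B = begin
  ∑< A g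
    ≡⟨ ∑-truncate g (m≤m+n A (suc M)) (λ j A≤j → cong (_* _) (c-vanish j A≤j)) ⟨
  ∑< (A + suc M) g
    ≡⟨ ∑-truncate g (m≤n+m (suc M) A) (λ j M<j → trans (cong (c j *_) (∑-δ-shift-> {B} f M<j)) (*-zeroʳ (c j))) ⟩
  ∑< (suc M) g
    ≡⟨ ∑-cong-< (suc M) (λ { j (s≤s j≤M) → cong (c j *_) (∑-δ-shift-≤ f j≤M M<B) }) ⟩
  ∑[ j < suc M ] (c j * f (M ∸ j)) ∎
  where
  g : ℕ → ℕ
  g j = c j * ∑[ r < B ] (δ M (j + r) * f r)

-- Binary digits and nim-sums

bit-suc : ∀ n → bit (suc n) ≡ not (bit n)
bit-suc zero    = refl
bit-suc (suc n) = trans (cong (λ x → ⌊ x ≟ 1 ⌋) (trans (%-congˡ (+-comm 2 n)) ([m+n]%n≡m%n n 2)))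
                        (sym (trans (cong not (bit-suc n)) (not-involutive (bit n))))

bit-+ : ∀ b n → bit (fromBit b + n) ≡ b xor bit n
bit-+ false n = refl
bit-+ true  n = bit-suc n

bit-+double : ∀ b q → bit (fromBit b + double q) ≡ b
bit-+double b q = begin
  bit (fromBit b + double q)       ≡⟨ cong (λ x → ⌊ (fromBit b + x) % 2 ≟ 1 ⌋) (trans (double≡2* q) (*-comm 2 q)) ⟩
  ⌊ (fromBit b + q * 2) % 2 ≟ 1 ⌋  ≡⟨ cong (λ x → ⌊ x ≟ 1 ⌋) ([m+kn]%n≡m%n (fromBit b) q 2) ⟩
  bit (fromBit b)                  ≡⟨ bit-fromBit b ⟩
  b                                ∎
  where
  bit-fromBit : ∀ b → bit (fromBit b) ≡ b
  bit-fromBit false = refl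
  bit-fromBit true  = refl

+double-/2 : ∀ b q → (fromBit b + double q) / 2 ≡ q
+double-/2 b q = begin
  (fromBit b + double q) / 2       ≡⟨ cong (λ x → (fromBit b + x) / 2) (trans (double≡2* q) (*-comm 2 q)) ⟩
  (fromBit b + q * 2) / 2          ≡⟨ +-distrib-/-∣ʳ (fromBit b) (divides-refl q) ⟩
  fromBit b / 2 + q * 2 / 2        ≡⟨ cong₂ _+_ (fromBit-/2 b) (m*n/n≡m q 2) ⟩
  q                                ∎
  where
  fromBit-/2 : ∀ b → fromBit b / 2 ≡ 0
  fromBit-/2 false = refl
  fromBit-/2 true  = refl

xorF-zero : ∀ f → xorF f 0 0 ≡ 0
xorF-zero zero    = refl
xorF-zero (suc f) = cong (2 *_) (xorF-zero f)

halves-≤ : ∀ a b f → a + b ≤ suc f → a / 2 + b / 2 ≤ f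
halves-≤ zero    zero    f _   = z≤n
halves-≤ zero    (suc b) f a+b≤ = ≤-pred (≤-trans (m/n<m (suc b) 2 (s≤s (s≤s z≤n))) a+b≤)
halves-≤ (suc a) b       f a+b≤ = ≤-pred (≤-trans (+-mono-<-≤ (m/n<m (suc a) 2 (s≤s (s≤s z≤n))) (m/n≤m b 2)) a+b≤)

-- Any fuel f ≥ a + b computes the full nim-sum, since the halving recursion reaches 0 ⊕ 0 within a + b steps.
xorF-fuel : ∀ f g a b → a + b ≤ f → a + b ≤ g → xorF f a b ≡ xorF g a b
xorF-fuel zero    g       zero zero _ _ = sym (xorF-zero g)
xorF-fuel (suc f) zero    zero zero _ _ = xorF-zero (suc f)
xorF-fuel (suc f) (suc g) a    b    ≤f ≤g =
  cong (λ x → fromBit (bit a xor bit b) + 2 * x) (xorF-fuel f g (a / 2) (b / 2) (halves-≤ a b f ≤f) (halves-≤ a b g ≤g))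

⊕-+double : ∀ b c q r → (fromBit b + double q) ⊕ (fromBit c + double r) ≡ fromBit (b xor c) + double (q ⊕ r)
⊕-+double b c q r = begin
  xorF (x + y) x y
    ≡⟨ xorF-fuel (x + y) (suc (x + y)) x y ≤-refl (n≤1+n _) ⟩
  fromBit (bit x xor bit y) + 2 * xorF (x + y) (x / 2) (y / 2)
    ≡⟨ cong₂ (λ u v → fromBit u + 2 * v) (cong₂ _xor_ (bit-+double b q) (bit-+double c r))
             (cong₂ (xorF (x + y)) (+double-/2 b q) (+double-/2 c r)) ⟩
  fromBit (b xor c) + 2 * xorF (x + y) q r
    ≡⟨ cong (λ z → fromBit (b xor c) + 2 * z) (xorF-fuel (x + y) (q + r) q r q+r≤x+y ≤-refl) ⟩
  fromBit (b xor c) + 2 * (q ⊕ r)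
    ≡⟨ cong (fromBit (b xor c) +_) (double≡2* (q ⊕ r)) ⟨
  fromBit (b xor c) + double (q ⊕ r) ∎
  where
  x = fromBit b + double q
  y = fromBit c + double r
  q+r≤x+y : q + r ≤ x + y
  q+r≤x+y = +-mono-≤ (≤-trans (n≤double q) (m≤n+m _ (fromBit b))) (≤-trans (n≤double r) (m≤n+m _ (fromBit c)))

-- Sums over boxes of pile sizes

-- Tuples are summed over the whole box [0,B)^k, the total being fixed by a Kronecker δ, so that
-- splitting every coordinate p < 2B as b + 2q is a mere reindexing of finite sums.
∑Box : (k B : ℕ) → (Vec ℕ k → ℕ) → ℕ
∑Box zero    B f = f []
∑Box (suc k) B f = ∑[ p < B ] ∑Box k B (λ v → f (p ∷ v))

∑Box-cong : ∀ k B {f g : Vec ℕ k → ℕ} → (∀ v → f v ≡ g v) → ∑Box k B f ≡ ∑Box k B g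
∑Box-cong zero    B eq = eq []
∑Box-cong (suc k) B eq = ∑-cong B (λ p → ∑Box-cong k B (λ v → eq (p ∷ v)))

∑Box-zero : ∀ k B {f : Vec ℕ k → ℕ} → (∀ v → f v ≡ 0) → ∑Box k B f ≡ 0
∑Box-zero zero    B eq = eq []
∑Box-zero (suc k) B eq = ∑-zero B (λ p → ∑Box-zero k B (λ v → eq (p ∷ v)))

*-distribˡ-∑Box : ∀ k B c (f : Vec ℕ k → ℕ) → c * ∑Box k B f ≡ ∑Box k B (λ v → c * f v)
*-distribˡ-∑Box zero    B c f = refl
*-distribˡ-∑Box (suc k) B c f = trans (*-distribˡ-∑ B c _) (∑-cong B (λ p → *-distribˡ-∑Box k B c (λ v → f (p ∷ v))))

∑Box-∑-comm : ∀ k B n (f : ℕ → Vec ℕ k → ℕ) → ∑Box k B (λ v → ∑[ r < n ] f r v) ≡ ∑[ r < n ] ∑Box k B (f r)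
∑Box-∑-comm zero    B n f = refl
∑Box-∑-comm (suc k) B n f = trans (∑-cong B (λ p → ∑Box-∑-comm k B n (λ r v → f r (p ∷ v))))
                                  (∑-comm B n (λ p r → ∑Box k B (λ v → f r (p ∷ v))))

∑Bits : (k : ℕ) → (Vec Bool k → ℕ) → ℕ
∑Bits zero    f = f []
∑Bits (suc k) f = ∑Bits k (λ bs → f (false ∷ bs)) + ∑Bits k (λ bs → f (true ∷ bs))

∑Bits-cong : ∀ k {f g : Vec Bool k → ℕ} → (∀ bs → f bs ≡ g bs) → ∑Bits k f ≡ ∑Bits k g
∑Bits-cong zero    eq = eq []
∑Bits-cong (suc k) eq = cong₂ _+_ (∑Bits-cong k (λ bs → eq (false ∷ bs))) (∑Bits-cong k (λ bs → eq (true ∷ bs)))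

∑-∑Bits-comm : ∀ n k (f : ℕ → Vec Bool k → ℕ) → ∑[ i < n ] ∑Bits k (f i) ≡ ∑Bits k (λ bs → ∑[ i < n ] f i bs)
∑-∑Bits-comm n zero    f = refl
∑-∑Bits-comm n (suc k) f = trans (∑-distrib-+ n _ _)
  (cong₂ _+_ (∑-∑Bits-comm n k (λ i bs → f i (false ∷ bs))) (∑-∑Bits-comm n k (λ i bs → f i (true ∷ bs))))

weight : ∀ {k} → Vec Bool k → ℕ
weight bs = Vec.sum (Vec.map fromBit bs)

∑Bits-weight : ∀ k (ψ : ℕ → ℕ) → ∑Bits k (ψ ∘ weight) ≡ ∑[ t < suc k ] ((k C t) * ψ t)
∑Bits-weight zero    ψ = sym (trans (+-identityʳ _) (+-identityʳ (ψ 0)))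
∑Bits-weight (suc k) ψ = begin
  ∑Bits k (ψ ∘ weight) + ∑Bits k (ψ ∘ suc ∘ weight)
    ≡⟨ cong₂ _+_ (∑Bits-weight k ψ) (∑Bits-weight k (ψ ∘ suc)) ⟩
  c₀ + ∑[ t < k ] upper t + ∑< (suc k) lower
    ≡⟨ cong (λ s → c₀ + s + ∑< (suc k) lower) (∑-truncate upper (n≤1+n k)
          (λ t k≤t → cong (_* ψ (suc t)) (k>n⇒nCk≡0 (s≤s k≤t)))) ⟨
  c₀ + ∑< (suc k) upper + ∑< (suc k) lower
    ≡⟨ +-assoc c₀ _ _ ⟩
  c₀ + (∑< (suc k) upper + ∑< (suc k) lower)
    ≡⟨ cong (c₀ +_) (trans (∑-distrib-+ (suc k) lower upper) (+-comm (∑< (suc k) lower) _)) ⟨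
  c₀ + ∑[ t < suc k ] (lower t + upper t)
    ≡⟨ cong (c₀ +_) (∑-cong (suc k) pascal) ⟩
  c₀ + ∑[ t < suc k ] ((suc k C suc t) * ψ (suc t)) ∎
  where
  c₀ = (k C 0) * ψ 0
  upper lower : ℕ → ℕ
  upper t = (k C suc t) * ψ (suc t)
  lower t = (k C t) * ψ (suc t)
  pascal : ∀ t → lower t + upper t ≡ (suc k C suc t) * ψ (suc t)
  pascal t = trans (sym (*-distribʳ-+ (ψ (suc t)) (k C t) _))
                   (cong (_* ψ (suc t)) (nCk+nC[k+1]≡[n+1]C[k+1] k t))

attachBits : ∀ {k} → Vec Bool k → Vec ℕ k → Vec ℕ k
attachBits = zipWith (λ b q → fromBit b + double q)

sum-attachBits : ∀ {k} (bs : Vec Bool k) qs → Vec.sum (attachBits bs qs) ≡ weight bs + double (Vec.sum qs)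
sum-attachBits []       []       = refl
sum-attachBits (b ∷ bs) (q ∷ qs) = begin
  fromBit b + double q + Vec.sum (attachBits bs qs)    ≡⟨ cong (fromBit b + double q +_) (sum-attachBits bs qs) ⟩
  fromBit b + double q + (weight bs + double s)        ≡⟨ +-interchange (fromBit b) (double q) _ _ ⟩
  fromBit b + weight bs + (double q + double s)        ≡⟨ cong (fromBit b + weight bs +_) (double-+ q s) ⟨
  fromBit b + weight bs + double (q + s)               ∎
  where
  s = Vec.sum qs

nimSum-attachBits : ∀ {k} (bs : Vec Bool k) qs →
  nimSum (toList (attachBits bs qs)) ≡ fromBit (bit (weight bs)) + double (nimSum (toList qs))
nimSum-attachBits []       []       = refl
nimSum-attachBits (b ∷ bs) (q ∷ qs) = begin
  (fromBit b + double q) ⊕ nimSum (toList (attachBits bs qs))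
    ≡⟨ cong ((fromBit b + double q) ⊕_) (nimSum-attachBits bs qs) ⟩
  (fromBit b + double q) ⊕ (fromBit (bit (weight bs)) + double x)
    ≡⟨ ⊕-+double b (bit (weight bs)) q x ⟩
  fromBit (b xor bit (weight bs)) + double (q ⊕ x)
    ≡⟨ cong (λ c → fromBit c + double (q ⊕ x)) (bit-+ b (weight bs)) ⟨
  fromBit (bit (fromBit b + weight bs)) + double (q ⊕ x) ∎
  where
  x = nimSum (toList qs)

δ-+double-0 : ∀ b n → δ (fromBit b + double n) 0 ≡ fromBit (not b) * δ n 0
δ-+double-0 true  n       = refl
δ-+double-0 false zero    = refl
δ-+double-0 false (suc n) = refl

∑Box-double : ∀ k B (g : Vec ℕ k → ℕ) → ∑Box k (double B) g ≡ ∑Bits k (λ bs → ∑Box k B (g ∘ attachBits bs))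
∑Box-double zero    B g = refl
∑Box-double (suc k) B g = begin
  ∑< (double B) F
    ≡⟨ ∑-double B F ⟩
  ∑[ q < B ] F (double q) + ∑[ q < B ] F (suc (double q))
    ≡⟨ cong₂ _+_ (∑-cong B (λ q → ∑Box-double k B (λ v → g (double q ∷ v))))
                 (∑-cong B (λ q → ∑Box-double k B (λ v → g (suc (double q) ∷ v)))) ⟩
  ∑[ q < B ] ∑Bits k (λ bs → ∑Box k B (λ qs → g (double q ∷ attachBits bs qs)))
    + ∑[ q < B ] ∑Bits k (λ bs → ∑Box k B (λ qs → g (suc (double q) ∷ attachBits bs qs)))
    ≡⟨ cong₂ _+_ (∑-∑Bits-comm B k _) (∑-∑Bits-comm B k _) ⟩
  ∑Bits (suc k) (λ bs → ∑Box (suc k) B (g ∘ attachBits bs)) ∎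
  where
  F : ℕ → ℕ
  F p = ∑Box k (double B) (λ v → g (p ∷ v))

-- Compositions as sums over boxes

length-filter≡sum : ∀ {A : Set} {Q : Pred A 0ℓ} (Q? : Decidable Q) xs →
  length (filter Q? xs) ≡ sum (map (fromBit ∘ does ∘ Q?) xs)
length-filter≡sum Q? []       = refl
length-filter≡sum Q? (x ∷ xs) with does (Q? x)
... | true  = cong suc (length-filter≡sum Q? xs)
... | false = length-filter≡sum Q? xs

sum-map-concatMap : ∀ {A B : Set} (g : B → ℕ) (f : A → List B) xs →
  sum (map g (concatMap f xs)) ≡ sum (map (λ x → sum (map g (f x))) xs)
sum-map-concatMap g f []       = refl
sum-map-concatMap g f (x ∷ xs) = begin
  sum (map g (f x ++ concatMap f xs))                ≡⟨ cong sum (map-++ g (f x) (concatMap f xs)) ⟩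
  sum (map g (f x) ++ map g (concatMap f xs))        ≡⟨ sum-++ (map g (f x)) _ ⟩
  sum (map g (f x)) + sum (map g (concatMap f xs))   ≡⟨ cong (sum (map g (f x)) +_) (sum-map-concatMap g f xs) ⟩
  sum (map g (f x)) + sum (map (λ x → sum (map g (f x))) xs) ∎

sum-applyUpTo : ∀ (f : ℕ → ℕ) n → sum (applyUpTo f n) ≡ ∑< n f
sum-applyUpTo f zero    = refl
sum-applyUpTo f (suc n) = cong (f 0 +_) (sum-applyUpTo (f ∘ suc) n)

sum-map-upTo : ∀ (f : ℕ → ℕ) n → sum (map f (upTo n)) ≡ ∑< n f
sum-map-upTo f n = trans (cong sum (map-upTo f n)) (sum-applyUpTo f n)

sum-map-compositions : ∀ k {m B} (g : List ℕ → ℕ) → m < B →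
  sum (map g (compositions k m)) ≡ ∑Box k B (λ v → δ m (Vec.sum v) * g (toList v))
sum-map-compositions zero    {zero}  g _   = refl
sum-map-compositions zero    {suc m} g _   = refl
sum-map-compositions (suc k) {m} {B} g m<B = begin
  sum (map g (concatMap (λ p → map (p ∷_) (compositions k (m ∸ p))) (upTo (suc m))))
    ≡⟨ sum-map-concatMap g (λ p → map (p ∷_) (compositions k (m ∸ p))) (upTo (suc m)) ⟩
  sum (map (λ p → sum (map g (map (p ∷_) (compositions k (m ∸ p))))) (upTo (suc m)))
    ≡⟨ sum-map-upTo _ (suc m) ⟩
  ∑[ p < suc m ] sum (map g (map (p ∷_) (compositions k (m ∸ p))))
    ≡⟨ ∑-cong-< (suc m) (λ { p (s≤s p≤m) → column p p≤m }) ⟩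
  ∑< (suc m) F
    ≡⟨ ∑-truncate F m<B (λ p m<p → ∑Box-zero k B (λ v → cong (_* _) (δ-< (<-≤-trans m<p (m≤m+n p _))))) ⟨
  ∑< B F ∎
  where
  F : ℕ → ℕ
  F p = ∑Box k B (λ v → δ m (p + Vec.sum v) * g (p ∷ toList v))
  column : ∀ p → p ≤ m → sum (map g (map (p ∷_) (compositions k (m ∸ p)))) ≡ F p
  column p p≤m = begin
    sum (map g (map (p ∷_) (compositions k (m ∸ p))))
      ≡⟨ cong sum (map-∘ (compositions k (m ∸ p))) ⟨
    sum (map (g ∘ (p ∷_)) (compositions k (m ∸ p)))
      ≡⟨ sum-map-compositions k (g ∘ (p ∷_)) (≤-<-trans (m∸n≤m m p) m<B) ⟩
    ∑Box k B (λ v → δ (m ∸ p) (Vec.sum v) * g (p ∷ toList v))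
      ≡⟨ ∑Box-cong k B (λ v → cong (_* g (p ∷ toList v)) (trans (sym (δ-cancelˡ-+ p (m ∸ p) _))
                                                                (cong (λ x → δ x (p + Vec.sum v)) (m+[n∸m]≡n p≤m)))) ⟩
    F p ∎

-- Counting P-positions

-- P k m counts the P-positions with exactly m counters, odd m included; D k n is P k (2 * n).
P : ℕ → ℕ → ℕ
P k m = length (filter (λ ps → nimSum ps ≟ 0) (compositions k m))

𝟙P : List ℕ → ℕ
𝟙P ps = δ (nimSum ps) 0

P≡∑Box : ∀ k {m B} → m < B → P k m ≡ ∑Box k B (λ v → δ m (Vec.sum v) * 𝟙P (toList v))
P≡∑Box k {m} m<B = trans (length-filter≡sum (λ ps → nimSum ps ≟ 0) (compositions k m))
                         (sum-map-compositions k 𝟙P m<B)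

∑Box-attachBits : ∀ k m (bs : Vec Bool k) →
  ∑Box k (suc m) (λ qs → δ m (Vec.sum (attachBits bs qs)) * 𝟙P (toList (attachBits bs qs)))
    ≡ fromBit (not (bit (weight bs))) * ∑[ r < suc m ] (δ m (weight bs + double r) * P k r)
∑Box-attachBits k m bs = begin
  ∑Box k B (λ qs → δ m (Vec.sum (attachBits bs qs)) * 𝟙P (toList (attachBits bs qs)))
    ≡⟨ ∑Box-cong k B (λ qs → cong₂ _*_ (cong (δ m) (sum-attachBits bs qs))
                                       (trans (cong (λ x → δ x 0) (nimSum-attachBits bs qs)) (δ-+double-0 (bit w) _))) ⟩
  ∑Box k B (λ qs → h (Vec.sum qs) * (c * 𝟙P (toList qs)))
    ≡⟨ ∑Box-cong k B (λ qs → x∙yz≈y∙xz (h (Vec.sum qs)) c _) ⟩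
  ∑Box k B (λ qs → c * (h (Vec.sum qs) * 𝟙P (toList qs)))
    ≡⟨ *-distribˡ-∑Box k B c _ ⟨
  c * ∑Box k B (λ qs → h (Vec.sum qs) * 𝟙P (toList qs))
    ≡⟨ cong (c *_) (∑Box-cong k B (λ qs → expand-total (Vec.sum qs) (𝟙P (toList qs)))) ⟩
  c * ∑Box k B (λ qs → ∑[ r < B ] (h r * (δ r (Vec.sum qs) * 𝟙P (toList qs))))
    ≡⟨ cong (c *_) (∑Box-∑-comm k B B (λ r qs → h r * (δ r (Vec.sum qs) * 𝟙P (toList qs)))) ⟩
  c * ∑[ r < B ] ∑Box k B (λ qs → h r * (δ r (Vec.sum qs) * 𝟙P (toList qs)))
    ≡⟨ cong (c *_) (∑-cong-< B (λ r r<B → trans (sym (*-distribˡ-∑Box k B (h r) _)) (cong (h r *_) (sym (P≡∑Box k r<B))))) ⟩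
  c * ∑[ r < B ] (h r * P k r) ∎
  where
  B = suc m
  w = weight bs
  c = fromBit (not (bit w))
  h : ℕ → ℕ
  h r = δ m (w + double r)
  expand-total : ∀ s x → h s * x ≡ ∑[ r < B ] (h r * (δ r s * x))
  expand-total s x = begin
    h s * x
      ≡⟨ ∑-δ B s (λ r → h r * x) (λ B≤s → cong (_* x) (δ-< (≤-trans B≤s (≤-trans (n≤double s) (m≤n+m _ w))))) ⟨
    ∑[ r < B ] (δ s r * (h r * x))
      ≡⟨ ∑-cong B (λ r → trans (cong (_* (h r * x)) (δ-sym s r)) (x∙yz≈y∙xz (δ r s) (h r) x)) ⟩
    ∑[ r < B ] (h r * (δ r s * x)) ∎

P-recurrence : ∀ k m →
  P k m ≡ ∑[ t < suc k ] ((k C t) * (fromBit (not (bit t)) * ∑[ r < suc m ] (δ m (t + double r) * P k r)))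
P-recurrence k m = begin
  P k m
    ≡⟨ P≡∑Box k (s≤s (≤-trans (n≤double m) (n≤1+n _))) ⟩
  ∑Box k (double (suc m)) (λ v → δ m (Vec.sum v) * 𝟙P (toList v))
    ≡⟨ ∑Box-double k (suc m) _ ⟩
  ∑Bits k (λ bs → ∑Box k (suc m) (λ qs → δ m (Vec.sum (attachBits bs qs)) * 𝟙P (toList (attachBits bs qs))))
    ≡⟨ ∑Bits-cong k (∑Box-attachBits k m) ⟩
  ∑Bits k (ψ ∘ weight)
    ≡⟨ ∑Bits-weight k ψ ⟩
  ∑[ t < suc k ] ((k C t) * ψ t) ∎
  where
  ψ : ℕ → ℕ
  ψ t = fromBit (not (bit t)) * ∑[ r < suc m ] (δ m (t + double r) * P k r)

P-recurrence-even : ∀ k m → P k m ≡ ∑[ j < suc k ] ((k C double j) * ∑[ r < suc m ] (δ m (double (j + r)) * P k r))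
P-recurrence-even k m = begin
  P k m
    ≡⟨ P-recurrence k m ⟩
  ∑< (suc k) T
    ≡⟨ ∑-truncate T (n≤double (suc k)) (λ t k<t → cong (_* (fromBit (not (bit t)) * S t)) (k>n⇒nCk≡0 k<t)) ⟨
  ∑< (double (suc k)) T
    ≡⟨ ∑-double (suc k) T ⟩
  ∑[ j < suc k ] T (double j) + ∑[ j < suc k ] T (suc (double j))
    ≡⟨ cong₂ _+_ (∑-cong (suc k) even) (∑-zero (suc k) odd) ⟩
  ∑[ j < suc k ] ((k C double j) * ∑[ r < suc m ] (δ m (double (j + r)) * P k r)) + 0
    ≡⟨ +-identityʳ _ ⟩
  ∑[ j < suc k ] ((k C double j) * ∑[ r < suc m ] (δ m (double (j + r)) * P k r)) ∎
  where
  S T : ℕ → ℕ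
  S t = ∑[ r < suc m ] (δ m (t + double r) * P k r)
  T t = (k C t) * (fromBit (not (bit t)) * S t)
  even : ∀ j → T (double j) ≡ (k C double j) * ∑[ r < suc m ] (δ m (double (j + r)) * P k r)
  even j = cong ((k C double j) *_) (begin
    fromBit (not (bit (double j))) * S (double j)
      ≡⟨ cong (λ b → fromBit (not b) * S (double j)) (bit-+double false j) ⟩
    1 * S (double j)
      ≡⟨ *-identityˡ (S (double j)) ⟩
    ∑[ r < suc m ] (δ m (double j + double r) * P k r)
      ≡⟨ ∑-cong (suc m) (λ r → cong (λ x → δ m x * P k r) (double-+ j r)) ⟨
    ∑[ r < suc m ] (δ m (double (j + r)) * P k r) ∎)
  odd : ∀ j → T (suc (double j)) ≡ 0
  odd j = trans (cong (λ b → (k C suc (double j)) * (fromBit (not b) * S (suc (double j)))) (bit-+double true j))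
                (*-zeroʳ (k C suc (double j)))

P-odd : ∀ k n → P k (suc (double n)) ≡ 0
P-odd k n = trans (P-recurrence-even k _) (∑-zero (suc k) (λ j →
  trans (cong ((k C double j) *_) (∑-zero (suc (suc (double n))) (λ r → cong (_* P k r) (δ-odd-double n (j + r)))))
        (*-zeroʳ (k C double j))))

P-even : ∀ k n → P k (double n) ≡ ∑[ j < suc n ] ((k C double j) * P k (n ∸ j))
P-even k n = begin
  P k (double n)
    ≡⟨ P-recurrence-even k (double n) ⟩
  ∑[ j < suc k ] ((k C double j) * ∑[ r < suc (double n) ] (δ (double n) (double (j + r)) * P k r))
    ≡⟨ ∑-cong (suc k) (λ j → cong ((k C double j) *_)
         (∑-cong (suc (double n)) (λ r → cong (_* P k r) (δ-double n (j + r))))) ⟩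
  ∑[ j < suc k ] ((k C double j) * ∑[ r < suc (double n) ] (δ n (j + r) * P k r))
    ≡⟨ ∑-convolution (λ j → k C double j) (P k) (λ j k<j → k>n⇒nCk≡0 (≤-trans k<j (n≤double j)))
                     (s≤s (n≤double n)) ⟩
  ∑[ j < suc n ] ((k C double j) * P k (n ∸ j)) ∎

D≡P : ∀ k n → D k n ≡ P k (double n)
D≡P k n = cong (P k) (sym (double≡2* n))

P-double-∸ : ∀ k n i → P k (double n ∸ double i) ≡ D k (n ∸ i)
P-double-∸ k n i = trans (cong (P k) (double-∸ n i)) (sym (D≡P k (n ∸ i)))

∑-P-odd : ∀ k n (c : ℕ → ℕ) → ∑[ i < suc n ] (c i * P k (suc (double n) ∸ double i)) ≡ 0
∑-P-odd k n c = trans (∑-cong-< (suc n) vanish) (∑-zero (suc n) (λ _ → refl))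
  where
  vanish : ∀ i → i < suc n → c i * P k (suc (double n) ∸ double i) ≡ 0
  vanish i (s≤s i≤n) = trans (cong (λ x → c i * P k x) (suc-double-∸ n i i≤n))
                             (trans (cong (c i *_) (P-odd k (n ∸ i))) (*-zeroʳ (c i)))

D-odd : ∀ k n → D k (2 * n + 1) ≡ Σ≤ n (λ i → (k C (4 * i + 2)) * D k (n ∸ i))
D-odd k n = begin
  D k (2 * n + 1)
    ≡⟨ D≡P k (2 * n + 1) ⟩
  P k (double (2 * n + 1))
    ≡⟨ cong (P k ∘ double) (trans (+-comm (2 * n) 1) (cong suc (sym (double≡2* n)))) ⟩
  P k (double (suc (double n)))
    ≡⟨ P-even k (suc (double n)) ⟩
  ∑< (double (suc n)) f
    ≡⟨ ∑-double (suc n) f ⟩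
  ∑[ i < suc n ] f (double i) + ∑[ i < suc n ] f (suc (double i))
    ≡⟨ cong₂ _+_ (∑-P-odd k n (λ i → k C double (double i)))
                 (∑-cong (suc n) (λ i → cong₂ _*_ (cong (k C_) (4i+2 i)) (P-double-∸ k n i))) ⟩
  ∑[ i < suc n ] ((k C (4 * i + 2)) * D k (n ∸ i))
    ≡⟨ sum-map-upTo (λ i → (k C (4 * i + 2)) * D k (n ∸ i)) (suc n) ⟨
  Σ≤ n (λ i → (k C (4 * i + 2)) * D k (n ∸ i)) ∎
  where
  f : ℕ → ℕ
  f j = (k C double j) * P k (suc (double n) ∸ j)
  4i+2 : ∀ i → double (suc (double i)) ≡ 4 * i + 2
  4i+2 i = trans (cong (suc ∘ suc) (double-double i)) (+-comm 2 (4 * i))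

D-even : ∀ k n → D k (2 * n + 2) ≡ Σ≤ (suc n) (λ i → (k C (4 * i)) * D k (suc n ∸ i))
D-even k n = begin
  D k (2 * n + 2)
    ≡⟨ D≡P k (2 * n + 2) ⟩
  P k (double (2 * n + 2))
    ≡⟨ cong (P k ∘ double) (trans (+-comm (2 * n) 2) (cong (suc ∘ suc) (sym (double≡2* n)))) ⟩
  P k (double (double (suc n)))
    ≡⟨ P-even k (double (suc n)) ⟩
  ∑< (suc (double (suc n))) g
    ≡⟨ ∑-double-suc (suc n) g ⟩
  ∑[ i < suc (suc n) ] g (double i) + ∑[ i < suc n ] g (suc (double i))
    ≡⟨ cong₂ _+_ (∑-cong (suc (suc n)) (λ i → cong₂ _*_ (cong (k C_) (double-double i)) (P-double-∸ k (suc n) i)))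
                 (∑-P-odd k n (λ i → k C double (suc (double i)))) ⟩
  ∑[ i < suc (suc n) ] ((k C (4 * i)) * D k (suc n ∸ i)) + 0
    ≡⟨ +-identityʳ _ ⟩
  ∑[ i < suc (suc n) ] ((k C (4 * i)) * D k (suc n ∸ i))
    ≡⟨ sum-map-upTo (λ i → (k C (4 * i)) * D k (suc n ∸ i)) (suc (suc n)) ⟨
  Σ≤ (suc n) (λ i → (k C (4 * i)) * D k (suc n ∸ i)) ∎
  where
  g : ℕ → ℕ
  g j = (k C double j) * P k (double (suc n) ∸ j)

theorem29 : (k : ℕ) → 1 ≤ k → (n : ℕ) →
    (D k (2 * n + 1) ≡ Σ≤ n (λ i → (k C (4 * i + 2)) * D k (n ∸ i)))
    × (D k (2 * n + 2) ≡ Σ≤ (suc n) (λ i → (k C (4 * i)) * D k (suc n ∸ i)))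
theorem29 k _ n = D-odd k n , D-even k n
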